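{- Let $S$ be a set of transpositions generating $S_n$, and let $G := \mathrm{Aut}(\mathrm{Cay}(S_n,S))$. If $g \in G_e$, then the restriction of $g$ to $S$ is an automorphism of the line graph of the transposition graph of $S$.
   Context: For a group $H$ and a subset $S \subseteq H$ with $1 \notin S$ and $S = S^{ -1}$, the Cayley graph $\mathrm{Cay}(H,S)$ is the simple undirected graph with vertex set $H$ and edges $\{h, sh\}$ for $h \in H$, $s \in S$. $G_e$ denotes the stabilizer in $G$ of the identity vertex $e$; such $g$ permutes the neighbors of $e$, which form the set $S$. The transposition graph $T(S)$ is the graph on $\{1,\ldots,n\}$ in which $i,j$ are adjacent iff $(i,j) \in S$; the vertex set of its line graph is identified with $S$ (two transpositions adjacent iff they share a point). -}

module Defs where

open import Data.Nat using (ℕ)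
open import Data.Fin using (Fin)
open import Data.Fin.Permutation using (Permutation′; _≈_; _∘ₚ_; id; transpose)
open import Data.List using (List; []; _∷_; foldr)
open import Data.List.Relation.Unary.All using (All)
open import Data.Product using (Σ; ∃; _×_)
open import Relation.Binary.PropositionalEquality using (_≡_)
open import Relation.Nullary using (¬_)
open import Function.Bundles using (_⇔_)

Perm : ℕ → Set
Perm n = Permutation′ n

SubsetOf : ℕ → Set₁
SubsetOf n = Perm n → Set

Respects≈ : ∀ {n} → SubsetOf n → Set
Respects≈ {n} S = ∀ {s t : Perm n} → s ≈ t → S s → S t

IsTransposition : ∀ {n} → Perm n → Set
IsTransposition {n} s = Σ (Fin n) λ i → Σ (Fin n) λ j → ¬ (i ≡ j) × s ≈ transpose i j

-- Product of a list of permutations s₁ s₂ ⋯ sₖ (as functions: s₁ ∘ s₂ ∘ ⋯ ∘ sₖ).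
-- Note: π ∘ₚ ρ applies π first, then ρ, i.e. it is the function ρ ∘ π.
prod : ∀ {n} → List (Perm n) → Perm n
prod = foldr (λ s acc → acc ∘ₚ s) id

-- S generates S_n: every permutation is a product of elements of S
-- (S = S⁻¹ since transpositions are involutions, so words suffice).
Generates : ∀ {n} → SubsetOf n → Set
Generates {n} S = ∀ (π : Perm n) → Σ (List (Perm n)) λ w → All S w × π ≈ prod w

-- Adjacency in Cay(S_n, S): h ~ k iff k = s h for some s ∈ S
-- (s h as a function = first h, then s = h ∘ₚ s).
CayAdj : ∀ {n} → SubsetOf n → Perm n → Perm n → Set
CayAdj {n} S h k = Σ (Perm n) λ s → S s × k ≈ (h ∘ₚ s)

record IsCayAut {n : ℕ} (S : SubsetOf n) (g : Perm n → Perm n) : Set where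
  field
    cong   : ∀ {x y} → x ≈ y → g x ≈ g y
    ginv   : Perm n → Perm n
    invˡ   : ∀ x → ginv (g x) ≈ x
    invʳ   : ∀ x → g (ginv x) ≈ x
    adj    : ∀ x y → CayAdj S x y ⇔ CayAdj S (g x) (g y)

-- Adjacency in the line graph of the transposition graph T(S):
-- vertices are the elements of S (edges {i,j} of T(S) ↔ transposition (i j) ∈ S);
-- two distinct ones are adjacent iff they share a point.
LineAdj : ∀ {n} → Perm n → Perm n → Set
LineAdj {n} s t = ¬ (s ≈ t) × Σ (Fin n) λ i → Σ (Fin n) λ j → Σ (Fin n) λ k →
  ¬ (i ≡ j) × ¬ (i ≡ k) × s ≈ transpose i j × t ≈ transpose i k

IsLineGraphAutOn : ∀ {n} → SubsetOf n → (Perm n → Perm n) → Set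
IsLineGraphAutOn {n} S g =
  (∀ s → S s → S (g s)) ×
  (∀ s t → S s → S t → g s ≈ g t → s ≈ t) ×
  (∀ t → S t → Σ (Perm n) λ s → S s × g s ≈ t) ×
  (∀ s t → S s → S t → LineAdj s t ⇔ LineAdj (g s) (g t))

module Submission where

-- An automorphism g fixing id permutes the neighbours of id, which are the elements of S.
-- Two transpositions s ≠ t in S are disjoint iff, besides id, they have exactly one common
-- neighbour: for disjoint s, t it is s ∘ₚ t, while if s = (i j) and t = (i k) share a point,
-- a second common neighbour forces (j k) ∈ S, and then s ∘ₚ t and s ∘ₚ (j k) are two of them.
-- Common neighbourhoods are preserved by g, hence so is adjacency in the line graph.

open import Defs
open import Data.Nat using (ℕ; zero; suc; _!)
open import Data.Nat.Properties using (n<1+n)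
open import Data.Fin using (Fin; zero; suc; punchIn; punchOut; combine; quotient; remainder)
open import Data.Fin.Properties
  using (_≟_; any?; punchIn-injective; punchOut-injective; <⇒notInjective; combine-remQuot; remQuot-combine)
open import Data.Fin.Permutation
  using (_≈_; _∘ₚ_; id; transpose; _⟨$⟩ʳ_; insert; remove; insert-remove; insert-punchIn)
open import Data.Fin.Permutation.Components using (transpose-inverse)
open import Data.Product using (∃; _×_; _,_; proj₁; proj₂)
open import Data.Product.Function.NonDependent.Propositional using (_×-⇔_)
open import Data.Sum using (_⊎_; inj₁; inj₂; map)
open import Function.Base using (_∘_)
open import Function.Bundles using (Injection; _⇔_; mk⇔; Equivalence)
open import Function.Construct.Composition using (_⇔-∘_)
open import Function.Construct.Symmetry using (⇔-sym)
open import Function.Definitions using (Injective)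
open import Function.Properties.Inverse using (↔⇒↣)
open import Function.Related.TypeIsomorphisms using (¬-cong-⇔)
open import Level using (0ℓ)
open import Relation.Binary.Bundles using (Setoid)
import Relation.Binary.Reasoning.Setoid
open import Relation.Binary.PropositionalEquality
open import Relation.Nullary using (¬_; yes; no; contradiction)
open import Relation.Nullary.Decidable using (dec-true; dec-false)

≈-setoid : ℕ → Setoid 0ℓ 0ℓ
≈-setoid n = record
  { Carrier       = Perm n
  ; _≈_           = _≈_
  ; isEquivalence = record
    { refl  = λ _ → refl
    ; sym   = λ π≈ρ i → sym (π≈ρ i)
    ; trans = λ π≈ρ ρ≈σ i → trans (π≈ρ i) (ρ≈σ i)
    }
  }

module ≈-Reasoning {n : ℕ} = Relation.Binary.Reasoning.Setoid (≈-setoid n)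

insert-cong : ∀ {n} (i j : Fin (suc n)) {ρ ρ′ : Perm n} → ρ ≈ ρ′ → insert i j ρ ≈ insert i j ρ′
insert-cong i j ρ≈ρ′ k with i ≟ k
... | yes _ = refl
... | no _ = cong (punchIn j) (ρ≈ρ′ _)

insert₀-injective : ∀ {n} {j j′ : Fin (suc n)} {ρ ρ′ : Perm n} →
                    insert zero j ρ ≈ insert zero j′ ρ′ → j ≡ j′ × ρ ≈ ρ′
insert₀-injective {j = j} {ρ = ρ} {ρ′} eq with eq zero
... | refl = refl , λ k → punchIn-injective j _ _ (begin
  punchIn j (ρ ⟨$⟩ʳ k)                    ≡⟨ insert-punchIn zero j ρ k ⟨
  insert zero j ρ ⟨$⟩ʳ suc k              ≡⟨ eq (suc k) ⟩
  insert zero j ρ′ ⟨$⟩ʳ suc k             ≡⟨ insert-punchIn zero j ρ′ k ⟩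
  punchIn j (ρ′ ⟨$⟩ʳ k)                   ∎)
  where open ≡-Reasoning

-- Iterates the bijection Perm (suc n) ≅ Fin (suc n) × Perm n, π ↦ (π 0 , remove 0 π).
enumerate : ∀ n → Fin (n !) → Perm n
enumerate zero    _ = id
enumerate (suc n) k = insert zero (quotient (n !) k) (enumerate n (remainder {suc n} (n !) k))

enumerate-surjective : ∀ n (π : Perm n) → ∃ λ k → enumerate n k ≈ π
enumerate-surjective zero    π = zero , λ ()
enumerate-surjective (suc n) π with r , r≈π₀ ← enumerate-surjective n (remove zero π) =
  combine (π ⟨$⟩ʳ zero) r , (begin
    enumerate (suc n) (combine (π ⟨$⟩ʳ zero) r)
      ≡⟨ cong (λ (j , r) → insert zero j (enumerate n r)) (remQuot-combine (π ⟨$⟩ʳ zero) r) ⟩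
    insert zero (π ⟨$⟩ʳ zero) (enumerate n r)
      ≈⟨ insert-cong zero (π ⟨$⟩ʳ zero) r≈π₀ ⟩
    insert zero (π ⟨$⟩ʳ zero) (remove zero π)
      ≈⟨ insert-remove zero π ⟩
    π ∎)
  where open ≈-Reasoning

enumerate-injective : ∀ n {k l : Fin (n !)} → enumerate n k ≈ enumerate n l → k ≡ l
enumerate-injective zero    {zero} {zero} _ = refl
enumerate-injective (suc n) {k} {l} eq with q≡q′ , r≈r′ ← insert₀-injective eq = begin
  k                                                        ≡⟨ combine-remQuot {suc n} (n !) k ⟨
  combine (quotient (n !) k) (remainder {suc n} (n !) k)   ≡⟨ cong₂ combine q≡q′ (enumerate-injective n r≈r′) ⟩
  combine (quotient (n !) l) (remainder {suc n} (n !) l)   ≡⟨ combine-remQuot {suc n} (n !) l ⟩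
  l                                                        ∎
  where open ≡-Reasoning

Fin-injective⇒surjective : ∀ {m} (f : Fin m → Fin m) → Injective _≡_ _≡_ f → ∀ i → ∃ λ k → f k ≡ i
Fin-injective⇒surjective {suc m} f f-inj i with any? (λ k → f k ≟ i)
... | yes hit = hit
... | no miss = contradiction (λ {k} {l} eq → f-inj {k} {l} (punchOut-injective {i = i} _ _ eq))
                              (<⇒notInjective {f = f′} (n<1+n m))
  where
  f′ : Fin (suc m) → Fin m
  f′ k = punchOut {i = i} {j = f k} (λ i≡fk → miss (k , sym i≡fk))

-- The section h need not respect ≈, so injectivity of g up to ≈ has to come from finiteness.
module _ {n : ℕ} {g h : Perm n → Perm n}
         (g-cong : ∀ {π ρ} → π ≈ ρ → g π ≈ g ρ) (g∘h≈id : ∀ π → g (h π) ≈ π) where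

  private
    index : Perm n → Fin (n !)
    index π = proj₁ (enumerate-surjective n π)

    enumerate-index : ∀ π → enumerate n (index π) ≈ π
    enumerate-index π = proj₂ (enumerate-surjective n π)

    pullback : Fin (n !) → Fin (n !)
    pullback k = index (h (enumerate n k))

    pullback-injective : Injective _≡_ _≡_ pullback
    pullback-injective {k} {l} eq = enumerate-injective n (begin
      enumerate n k              ≈⟨ g∘h≈id _ ⟨
      g (h (enumerate n k))      ≈⟨ g-cong (begin
        h (enumerate n k)                   ≈⟨ enumerate-index _ ⟨
        enumerate n (pullback k)            ≡⟨ cong (enumerate n) eq ⟩
        enumerate n (pullback l)            ≈⟨ enumerate-index _ ⟩
        h (enumerate n l)                   ∎) ⟩
      g (h (enumerate n l))      ≈⟨ g∘h≈id _ ⟩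
      enumerate n l              ∎)
      where open ≈-Reasoning

  section-surjective : ∀ π → ∃ λ k → h (enumerate n k) ≈ π
  section-surjective π with k , pullback-k≡ ← Fin-injective⇒surjective pullback pullback-injective (index π) =
    k , (begin
      h (enumerate n k)          ≈⟨ enumerate-index _ ⟨
      enumerate n (pullback k)   ≡⟨ cong (enumerate n) pullback-k≡ ⟩
      enumerate n (index π)      ≈⟨ enumerate-index π ⟩
      π                          ∎)
    where open ≈-Reasoning

  injective-of-section : ∀ {π ρ} → g π ≈ g ρ → π ≈ ρ
  injective-of-section {π} {ρ} gπ≈gρ
    with k , hk≈π ← section-surjective π | l , hl≈ρ ← section-surjective ρ = begin
      π                          ≈⟨ hk≈π ⟨
      h (enumerate n k)          ≡⟨ cong (h ∘ enumerate n) (enumerate-injective n ek≈el) ⟩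
      h (enumerate n l)          ≈⟨ hl≈ρ ⟩
      ρ                          ∎
    where
    open ≈-Reasoning
    ek≈el : enumerate n k ≈ enumerate n l
    ek≈el = begin
      enumerate n k              ≈⟨ g∘h≈id _ ⟨
      g (h (enumerate n k))      ≈⟨ g-cong hk≈π ⟩
      g π                        ≈⟨ gπ≈gρ ⟩
      g ρ                        ≈⟨ g-cong hl≈ρ ⟨
      g (h (enumerate n l))      ≈⟨ g∘h≈id _ ⟩
      enumerate n l              ∎

module _ {n : ℕ} where

  ∘ₚ-congˡ : (π : Perm n) {σ σ′ : Perm n} → σ ≈ σ′ → π ∘ₚ σ ≈ π ∘ₚ σ′
  ∘ₚ-congˡ π σ≈σ′ z = σ≈σ′ (π ⟨$⟩ʳ z)

  ⟨$⟩ʳ-injective : (π : Perm n) → Injective _≡_ _≡_ (π ⟨$⟩ʳ_)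
  ⟨$⟩ʳ-injective π = Injection.injective (↔⇒↣ π)

  transpose-left : (i j : Fin n) → transpose i j ⟨$⟩ʳ i ≡ j
  transpose-left i j rewrite dec-true (i ≟ i) refl = refl

  transpose-right : (i j : Fin n) → transpose i j ⟨$⟩ʳ j ≡ i
  transpose-right i j with j ≟ i
  ... | yes j≡i = j≡i
  ... | no _ rewrite dec-true (j ≟ j) refl = refl

  transpose-outside : {i j k : Fin n} → k ≢ i → k ≢ j → transpose i j ⟨$⟩ʳ k ≡ k
  transpose-outside {i} {j} {k} k≢i k≢j rewrite dec-false (k ≟ i) k≢i | dec-false (k ≟ j) k≢j = refl

  data Position (z i j : Fin n) : Set where
    at-left  : z ≡ i → Position z i j
    at-right : z ≢ i → z ≡ j → Position z i j
    outside  : z ≢ i → z ≢ j → Position z i j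

  position : (z i j : Fin n) → Position z i j
  position z i j with z ≟ i | z ≟ j
  ... | yes z≡i | _       = at-left z≡i
  ... | no z≢i  | yes z≡j = at-right z≢i z≡j
  ... | no z≢i  | no z≢j  = outside z≢i z≢j

  transpose-sym : (i j : Fin n) → transpose i j ≈ transpose j i
  transpose-sym i j z with position z i j
  ... | at-left refl        = trans (transpose-left z j) (sym (transpose-right j z))
  ... | at-right _ refl     = trans (transpose-right i z) (sym (transpose-left z i))
  ... | outside z≢i z≢j     = trans (transpose-outside z≢i z≢j) (sym (transpose-outside z≢j z≢i))

  -- Conjugation; note that π ∘ₚ σ applies π first.
  transpose-∘ₚ : (i j : Fin n) (π : Perm n) →
                 transpose i j ∘ₚ π ≈ π ∘ₚ transpose (π ⟨$⟩ʳ i) (π ⟨$⟩ʳ j)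
  transpose-∘ₚ i j π z with position z i j
  ... | at-left refl      = trans (cong (π ⟨$⟩ʳ_) (transpose-left i j))
                                  (sym (transpose-left (π ⟨$⟩ʳ i) (π ⟨$⟩ʳ j)))
  ... | at-right z≢i refl = trans (cong (π ⟨$⟩ʳ_) (transpose-right i z))
                                  (sym (transpose-right (π ⟨$⟩ʳ i) (π ⟨$⟩ʳ z)))
  ... | outside z≢i z≢j   = trans (cong (π ⟨$⟩ʳ_) (transpose-outside z≢i z≢j))
      (sym (transpose-outside (z≢i ∘ ⟨$⟩ʳ-injective π) (z≢j ∘ ⟨$⟩ʳ-injective π)))

  transpose-∘ₚ-cancel : (i j : Fin n) {a : Perm n} → a ≈ transpose i j → transpose i j ∘ₚ a ≈ id
  transpose-∘ₚ-cancel i j a≈ z =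
    trans (a≈ _) (trans (cong (transpose i j ⟨$⟩ʳ_) (transpose-sym i j z)) (transpose-inverse i j))

  transposition-determined : (τ : Perm n) → IsTransposition τ →
                             {x y : Fin n} → τ ⟨$⟩ʳ x ≡ y → x ≢ y → τ ≈ transpose x y
  transposition-determined τ (p , q , _ , τ≈) {x} {y} τx≡y x≢y with position x p q
  ... | at-left refl = λ z → trans (τ≈ z) (cong (λ w → transpose x w ⟨$⟩ʳ z) q≡y)
    where
    q≡y : q ≡ y
    q≡y = trans (sym (transpose-left x q)) (trans (sym (τ≈ x)) τx≡y)
  ... | at-right _ refl =
    λ z → trans (τ≈ z) (trans (transpose-sym p x z) (cong (λ w → transpose x w ⟨$⟩ʳ z) p≡y))
    where
    p≡y : p ≡ y
    p≡y = trans (sym (transpose-right p x)) (trans (sym (τ≈ x)) τx≡y)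
  ... | outside x≢p x≢q = contradiction (trans (sym (transpose-outside x≢p x≢q)) (trans (sym (τ≈ x)) τx≡y)) x≢y

  transpose-commute : {i j k l : Fin n} → i ≢ k → i ≢ l → j ≢ k → j ≢ l →
                      transpose i j ∘ₚ transpose k l ≈ transpose k l ∘ₚ transpose i j
  transpose-commute {i} {j} {k} {l} i≢k i≢l j≢k j≢l = begin
    transpose i j ∘ₚ transpose k l
      ≈⟨ transpose-∘ₚ i j (transpose k l) ⟩
    transpose k l ∘ₚ transpose (transpose k l ⟨$⟩ʳ i) (transpose k l ⟨$⟩ʳ j)
      ≡⟨ cong₂ (λ x y → transpose k l ∘ₚ transpose x y)
               (transpose-outside i≢k i≢l) (transpose-outside j≢k j≢l) ⟩
    transpose k l ∘ₚ transpose i j ∎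
    where open ≈-Reasoning

  triangle-relation₁ : {i j k : Fin n} → i ≢ j → i ≢ k → j ≢ k →
                       transpose i j ∘ₚ transpose i k ≈ transpose i k ∘ₚ transpose j k
  triangle-relation₁ {i} {j} {k} i≢j i≢k j≢k = begin
    transpose i j ∘ₚ transpose i k
      ≈⟨ transpose-∘ₚ i j (transpose i k) ⟩
    transpose i k ∘ₚ transpose (transpose i k ⟨$⟩ʳ i) (transpose i k ⟨$⟩ʳ j)
      ≡⟨ cong₂ (λ x y → transpose i k ∘ₚ transpose x y) (transpose-left i k) (transpose-outside (≢-sym i≢j) j≢k) ⟩
    transpose i k ∘ₚ transpose k j
      ≈⟨ ∘ₚ-congˡ (transpose i k) {transpose k j} {transpose j k} (transpose-sym k j) ⟩
    transpose i k ∘ₚ transpose j k ∎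
    where open ≈-Reasoning

  triangle-relation₂ : {i j k : Fin n} → i ≢ j → i ≢ k → j ≢ k →
                       transpose i j ∘ₚ transpose j k ≈ transpose i k ∘ₚ transpose i j
  triangle-relation₂ {i} {j} {k} i≢j i≢k j≢k = begin
    transpose i j ∘ₚ transpose j k
      ≡⟨ cong₂ (λ x y → transpose i j ∘ₚ transpose x y)
               (transpose-left i j) (transpose-outside (≢-sym i≢k) (≢-sym j≢k)) ⟨
    transpose i j ∘ₚ transpose (transpose i j ⟨$⟩ʳ i) (transpose i j ⟨$⟩ʳ k)
      ≈⟨ transpose-∘ₚ i k (transpose i j) ⟨
    transpose i k ∘ₚ transpose i j ∎
    where open ≈-Reasoning

  SharesPoint : Perm n → Perm n → Set
  SharesPoint s t = ∃ λ i → ∃ λ j → ∃ λ k →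
    i ≢ j × i ≢ k × s ≈ transpose i j × t ≈ transpose i k

  Disjoint : Perm n → Perm n → Set
  Disjoint s t = ∃ λ i → ∃ λ j → ∃ λ k → ∃ λ l →
    i ≢ j × k ≢ l × i ≢ k × i ≢ l × j ≢ k × j ≢ l × s ≈ transpose i j × t ≈ transpose k l

  sharesPoint⊎disjoint : {s t : Perm n} → IsTransposition s → IsTransposition t → SharesPoint s t ⊎ Disjoint s t
  sharesPoint⊎disjoint {s} {t} (i , j , i≢j , s≈) (k , l , k≢l , t≈) with i ≟ k | i ≟ l | j ≟ k | j ≟ l
  ... | yes refl | _ | _ | _ = inj₁ (i , j , l , i≢j , k≢l , s≈ , t≈)
  ... | no _ | yes refl | _ | _ = inj₁ (i , j , k , i≢j , ≢-sym k≢l , s≈ , t≈′)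
    where t≈′ = λ z → trans (t≈ z) (transpose-sym k i z)
  ... | no _ | no _ | yes refl | _ = inj₁ (j , i , l , ≢-sym i≢j , k≢l , s≈′ , t≈)
    where s≈′ = λ z → trans (s≈ z) (transpose-sym i j z)
  ... | no _ | no _ | no _ | yes refl = inj₁ (j , i , k , ≢-sym i≢j , ≢-sym k≢l , s≈′ , t≈′)
    where s≈′ = λ z → trans (s≈ z) (transpose-sym i j z)
          t≈′ = λ z → trans (t≈ z) (transpose-sym k j z)
  ... | no i≢k | no i≢l | no j≢k | no j≢l =
    inj₂ (i , j , k , l , i≢j , k≢l , i≢k , i≢l , j≢k , j≢l , s≈ , t≈)

  -- A common neighbour of (i j) and t in the Cayley graph, written in both ways.
  module Factorisation (a b t : Perm n) {i j : Fin n} (i≢j : i ≢ j)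
         (a-tr : IsTransposition a) (b-tr : IsTransposition b)
         (t-fixes-j : t ⟨$⟩ʳ j ≡ j) (eq : transpose i j ∘ₚ a ≈ t ∘ₚ b) where

    b-at-j : b ⟨$⟩ʳ j ≡ a ⟨$⟩ʳ i
    b-at-j = begin
      b ⟨$⟩ʳ j                          ≡⟨ cong (b ⟨$⟩ʳ_) t-fixes-j ⟨
      b ⟨$⟩ʳ (t ⟨$⟩ʳ j)                 ≡⟨ eq j ⟨
      a ⟨$⟩ʳ (transpose i j ⟨$⟩ʳ j)     ≡⟨ cong (a ⟨$⟩ʳ_) (transpose-right i j) ⟩
      a ⟨$⟩ʳ i                          ∎
      where open ≡-Reasoning

    b-when-a-fixes-i : a ⟨$⟩ʳ i ≡ i → b ≈ transpose j i
    b-when-a-fixes-i a-fixes-i = transposition-determined b b-tr (trans b-at-j a-fixes-i) (≢-sym i≢j)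

    when-a-moves-i : a ⟨$⟩ʳ i ≢ i → a ⟨$⟩ʳ i ≢ j →
                     t ⟨$⟩ʳ i ≡ a ⟨$⟩ʳ i × b ≈ transpose j (a ⟨$⟩ʳ i)
    when-a-moves-i m≢i m≢j = ⟨$⟩ʳ-injective b (trans b∘t-at-i (sym b-at-m)) , b≈
      where
      m = a ⟨$⟩ʳ i
      open ≡-Reasoning
      a≈ : a ≈ transpose i m
      a≈ = transposition-determined a a-tr refl (≢-sym m≢i)
      b≈ : b ≈ transpose j m
      b≈ = transposition-determined b b-tr b-at-j (≢-sym m≢j)
      b∘t-at-i : b ⟨$⟩ʳ (t ⟨$⟩ʳ i) ≡ j
      b∘t-at-i = begin
        b ⟨$⟩ʳ (t ⟨$⟩ʳ i)               ≡⟨ eq i ⟨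
        a ⟨$⟩ʳ (transpose i j ⟨$⟩ʳ i)   ≡⟨ cong (a ⟨$⟩ʳ_) (transpose-left i j) ⟩
        a ⟨$⟩ʳ j                        ≡⟨ a≈ j ⟩
        transpose i m ⟨$⟩ʳ j            ≡⟨ transpose-outside (≢-sym i≢j) (≢-sym m≢j) ⟩
        j                               ∎
      b-at-m : b ⟨$⟩ʳ m ≡ j
      b-at-m = trans (b≈ m) (transpose-right j m)

  disjoint-factorisation : {a b : Perm n} {i j k l : Fin n} →
    i ≢ j → k ≢ l → i ≢ k → i ≢ l → j ≢ k → j ≢ l →
    IsTransposition a → IsTransposition b → transpose i j ∘ₚ a ≈ transpose k l ∘ₚ b →
    a ≈ transpose i j ⊎ a ≈ transpose k l
  disjoint-factorisation {a} {b} {i} {j} {k} {l} i≢j k≢l i≢k i≢l j≢k j≢l a-tr b-tr eq =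
    cases (position (a ⟨$⟩ʳ i) i j)
    where
    open Factorisation a b (transpose k l) i≢j a-tr b-tr (transpose-outside j≢k j≢l) eq
    cases : Position (a ⟨$⟩ʳ i) i j → a ≈ transpose i j ⊎ a ≈ transpose k l
    cases (at-left a-fixes-i) = inj₂ (transposition-determined a a-tr a-at-k k≢l)
      where
      open ≡-Reasoning
      a-at-k : a ⟨$⟩ʳ k ≡ l
      a-at-k = begin
        a ⟨$⟩ʳ k                          ≡⟨ cong (a ⟨$⟩ʳ_) (transpose-outside (≢-sym i≢k) (≢-sym j≢k)) ⟨
        a ⟨$⟩ʳ (transpose i j ⟨$⟩ʳ k)     ≡⟨ eq k ⟩
        b ⟨$⟩ʳ (transpose k l ⟨$⟩ʳ k)     ≡⟨ cong (b ⟨$⟩ʳ_) (transpose-left k l) ⟩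
        b ⟨$⟩ʳ l                          ≡⟨ b-when-a-fixes-i a-fixes-i l ⟩
        transpose j i ⟨$⟩ʳ l              ≡⟨ transpose-outside (≢-sym j≢l) (≢-sym i≢l) ⟩
        l                                 ∎
    cases (at-right _ a-at-i) = inj₁ (transposition-determined a a-tr a-at-i i≢j)
    cases (outside m≢i m≢j) =
      contradiction (trans (sym (transpose-outside i≢k i≢l)) (proj₁ (when-a-moves-i m≢i m≢j))) (≢-sym m≢i)

  shared-factorisation : {a b : Perm n} {i j k : Fin n} → i ≢ j → i ≢ k → j ≢ k →
    IsTransposition a → IsTransposition b → transpose i j ∘ₚ a ≈ transpose i k ∘ₚ b →
    a ≈ transpose i j ⊎ a ≈ transpose j k ⊎ b ≈ transpose j k
  shared-factorisation {a} {b} {i} {j} {k} i≢j i≢k j≢k a-tr b-tr eq =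
    cases (position (a ⟨$⟩ʳ i) i j)
    where
    open Factorisation a b (transpose i k) i≢j a-tr b-tr (transpose-outside (≢-sym i≢j) j≢k) eq
    cases : Position (a ⟨$⟩ʳ i) i j → a ≈ transpose i j ⊎ a ≈ transpose j k ⊎ b ≈ transpose j k
    cases (at-left a-fixes-i) = inj₂ (inj₁ (transposition-determined a a-tr a-at-j j≢k))
      where
      open ≡-Reasoning
      a-at-j : a ⟨$⟩ʳ j ≡ k
      a-at-j = begin
        a ⟨$⟩ʳ j                          ≡⟨ cong (a ⟨$⟩ʳ_) (transpose-left i j) ⟨
        a ⟨$⟩ʳ (transpose i j ⟨$⟩ʳ i)     ≡⟨ eq i ⟩
        b ⟨$⟩ʳ (transpose i k ⟨$⟩ʳ i)     ≡⟨ cong (b ⟨$⟩ʳ_) (transpose-left i k) ⟩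
        b ⟨$⟩ʳ k                          ≡⟨ b-when-a-fixes-i a-fixes-i k ⟩
        transpose j i ⟨$⟩ʳ k              ≡⟨ transpose-outside (≢-sym j≢k) (≢-sym i≢k) ⟩
        k                                 ∎
    cases (at-right _ a-at-i) = inj₁ (transposition-determined a a-tr a-at-i i≢j)
    cases (outside m≢i m≢j) with t-at-i , b≈ ← when-a-moves-i m≢i m≢j =
      inj₂ (inj₂ λ z → trans (b≈ z) (cong (λ w → transpose j w ⟨$⟩ʳ z) (sym k≡m)))
      where
      k≡m : k ≡ a ⟨$⟩ʳ i
      k≡m = trans (sym (transpose-left i k)) t-at-i

module _ {n : ℕ} (S : SubsetOf n) where

  CayAdj-resp : {x x′ y y′ : Perm n} → x ≈ x′ → y ≈ y′ → CayAdj S x y → CayAdj S x′ y′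
  CayAdj-resp x≈x′ y≈y′ (a , Sa , y≈xa) =
    a , Sa , λ z → trans (sym (y≈y′ z)) (trans (y≈xa z) (cong (a ⟨$⟩ʳ_) (x≈x′ z)))

  CommonNbr : (s t y : Perm n) → Set
  CommonNbr s t y = CayAdj S s y × CayAdj S t y

  UniqueNonIdCommonNbr : (s t : Perm n) → Set
  UniqueNonIdCommonNbr s t =
    ∃ λ x → ¬ x ≈ id × CommonNbr s t x × (∀ y → CommonNbr s t y → y ≈ id ⊎ y ≈ x)

  CommonNbr-resp : {s s′ t t′ y : Perm n} → s ≈ s′ → t ≈ t′ → CommonNbr s t y → CommonNbr s′ t′ y
  CommonNbr-resp {s} {s′} {t} {t′} {y} s≈s′ t≈t′ (s~y , t~y) =
    CayAdj-resp {s} {s′} {y} {y} s≈s′ (λ _ → refl) s~y , CayAdj-resp {t} {t′} {y} {y} t≈t′ (λ _ → refl) t~y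

  UniqueNonIdCommonNbr-resp : {s s′ t t′ : Perm n} → s ≈ s′ → t ≈ t′ →
                              UniqueNonIdCommonNbr s t → UniqueNonIdCommonNbr s′ t′
  UniqueNonIdCommonNbr-resp {s} {s′} {t} {t′} s≈s′ t≈t′ (x , x≉id , common , unique) =
    x , x≉id , CommonNbr-resp {s} {s′} {t} {t′} {x} s≈s′ t≈t′ common ,
    λ y common′ → unique y
      (CommonNbr-resp {s′} {s} {t′} {t} {y} (λ z → sym (s≈s′ z)) (λ z → sym (t≈t′ z)) common′)

module _ {n : ℕ} {S : SubsetOf n} (S-resp : Respects≈ S) (S-tr : ∀ s → S s → IsTransposition s) where

  disjoint⇒uniqueNonIdCommonNbr : {s t : Perm n} → S s → S t → Disjoint s t → UniqueNonIdCommonNbr S s t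
  disjoint⇒uniqueNonIdCommonNbr {s} {t} Ss St (i , j , k , l , i≢j , k≢l , i≢k , i≢l , j≢k , j≢l , s≈ , t≈) =
    UniqueNonIdCommonNbr-resp S {σ} {s} {τ} {t} (λ z → sym (s≈ z)) (λ z → sym (t≈ z))
      (square (S-resp {s} s≈ Ss) (S-resp {t} t≈ St))
    where
    σ = transpose i j
    τ = transpose k l
    square : S σ → S τ → UniqueNonIdCommonNbr S σ τ
    square Sσ Sτ =
      σ ∘ₚ τ , σ∘τ≉id , ((τ , Sτ , λ _ → refl) , (σ , Sσ , transpose-commute i≢k i≢l j≢k j≢l)) , unique
      where
      σ∘τ≉id : ¬ σ ∘ₚ τ ≈ id
      σ∘τ≉id σ∘τ≈id = i≢j (begin
        i                   ≡⟨ σ∘τ≈id i ⟨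
        τ ⟨$⟩ʳ (σ ⟨$⟩ʳ i)   ≡⟨ cong (τ ⟨$⟩ʳ_) (transpose-left i j) ⟩
        τ ⟨$⟩ʳ j            ≡⟨ transpose-outside j≢k j≢l ⟩
        j                   ∎)
        where open ≡-Reasoning
      unique : ∀ y → CommonNbr S σ τ y → y ≈ id ⊎ y ≈ σ ∘ₚ τ
      unique y ((a , Sa , y≈σ∘a) , (b , Sb , y≈τ∘b))
        with disjoint-factorisation {a = a} {b} i≢j k≢l i≢k i≢l j≢k j≢l (S-tr a Sa) (S-tr b Sb)
               (λ z → trans (sym (y≈σ∘a z)) (y≈τ∘b z))
      ... | inj₁ a≈σ = inj₁ λ z → trans (y≈σ∘a z) (transpose-∘ₚ-cancel i j {a} a≈σ z)
      ... | inj₂ a≈τ = inj₂ λ z → trans (y≈σ∘a z) (∘ₚ-congˡ σ {a} {τ} a≈τ z)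

  sharesPoint⇒¬uniqueNonIdCommonNbr : {s t : Perm n} → S s → S t → ¬ s ≈ t → SharesPoint s t →
                                      ¬ UniqueNonIdCommonNbr S s t
  sharesPoint⇒¬uniqueNonIdCommonNbr {s} {t} Ss St s≉t (i , j , k , i≢j , i≢k , s≈ , t≈) unique-s-t =
    no-unique (S-resp {s} s≈ Ss) (S-resp {t} t≈ St)
              (UniqueNonIdCommonNbr-resp S {s} {σ} {t} {τ} s≈ t≈ unique-s-t)
    where
    σ = transpose i j
    τ = transpose i k
    ρ = transpose j k
    j≢k : j ≢ k
    j≢k refl = s≉t λ z → trans (s≈ z) (sym (t≈ z))
    σ∘τ-at-i : (σ ∘ₚ τ) ⟨$⟩ʳ i ≡ j
    σ∘τ-at-i = trans (cong (τ ⟨$⟩ʳ_) (transpose-left i j)) (transpose-outside (≢-sym i≢j) j≢k)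
    σ∘ρ-at-i : (σ ∘ₚ ρ) ⟨$⟩ʳ i ≡ k
    σ∘ρ-at-i = trans (cong (ρ ⟨$⟩ʳ_) (transpose-left i j)) (transpose-left j k)
    no-unique : S σ → S τ → ¬ UniqueNonIdCommonNbr S σ τ
    no-unique Sσ Sτ (x , x≉id , ((a , Sa , x≈σ∘a) , (b , Sb , x≈τ∘b)) , unique) = j≢k (begin
      j                    ≡⟨ σ∘τ-at-i ⟨
      (σ ∘ₚ τ) ⟨$⟩ʳ i      ≡⟨ moving-common≈x (σ ∘ₚ τ) σ∘τ-common (λ e → i≢j (trans (sym e) σ∘τ-at-i)) i ⟩
      x ⟨$⟩ʳ i             ≡⟨ moving-common≈x (σ ∘ₚ ρ) σ∘ρ-common (λ e → i≢k (trans (sym e) σ∘ρ-at-i)) i ⟨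
      (σ ∘ₚ ρ) ⟨$⟩ʳ i      ≡⟨ σ∘ρ-at-i ⟩
      k                    ∎)
      where
      open ≡-Reasoning
      Sρ : S ρ
      Sρ with shared-factorisation {a = a} {b} i≢j i≢k j≢k (S-tr a Sa) (S-tr b Sb)
                (λ z → trans (sym (x≈σ∘a z)) (x≈τ∘b z))
      ... | inj₁ a≈σ = contradiction (λ z → trans (x≈σ∘a z) (transpose-∘ₚ-cancel i j {a} a≈σ z)) x≉id
      ... | inj₂ (inj₁ a≈ρ) = S-resp {a} a≈ρ Sa
      ... | inj₂ (inj₂ b≈ρ) = S-resp {b} b≈ρ Sb
      moving-common≈x : ∀ y → CommonNbr S σ τ y → y ⟨$⟩ʳ i ≢ i → y ≈ x
      moving-common≈x y common y-moves-i with unique y common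
      ... | inj₁ y≈id = contradiction (y≈id i) y-moves-i
      ... | inj₂ y≈x = y≈x
      σ∘τ-common : CommonNbr S σ τ (σ ∘ₚ τ)
      σ∘τ-common = (τ , Sτ , λ _ → refl) , (ρ , Sρ , triangle-relation₁ i≢j i≢k j≢k)
      σ∘ρ-common : CommonNbr S σ τ (σ ∘ₚ ρ)
      σ∘ρ-common = (ρ , Sρ , λ _ → refl) , (σ , Sσ , triangle-relation₂ i≢j i≢k j≢k)

  LineAdj⇔¬uniqueNonIdCommonNbr : {s t : Perm n} → S s → S t →
                                  LineAdj s t ⇔ (¬ s ≈ t × ¬ UniqueNonIdCommonNbr S s t)
  LineAdj⇔¬uniqueNonIdCommonNbr {s} {t} Ss St = mk⇔ to from
    where
    to : LineAdj s t → ¬ s ≈ t × ¬ UniqueNonIdCommonNbr S s t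
    to (s≉t , shares) = s≉t , sharesPoint⇒¬uniqueNonIdCommonNbr Ss St s≉t shares
    from : ¬ s ≈ t × ¬ UniqueNonIdCommonNbr S s t → LineAdj s t
    from (s≉t , ¬unique) with sharesPoint⊎disjoint {s = s} {t} (S-tr s Ss) (S-tr t St)
    ... | inj₁ shares   = s≉t , shares
    ... | inj₂ disjoint = contradiction (disjoint⇒uniqueNonIdCommonNbr Ss St disjoint) ¬unique

  CayAdj-id⇔ : {y : Perm n} → CayAdj S id y ⇔ S y
  CayAdj-id⇔ {y} = mk⇔ (λ (a , Sa , y≈a) → S-resp {a} (λ z → sym (y≈a z)) Sa) (λ Sy → y , Sy , λ _ → refl)

  module CayleyAutomorphism {g : Perm n → Perm n} (aut : IsCayAut S g) (g-id : g id ≈ id) where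
    open IsCayAut aut renaming (cong to g-cong)
    open Equivalence

    g-injective : {π ρ : Perm n} → g π ≈ g ρ → π ≈ ρ
    g-injective {π} {ρ} = injective-of-section {g = g} {ginv} g-cong invʳ {π} {ρ}

    g-maps-S : {s : Perm n} → S s → S (g s)
    g-maps-S {s} Ss = to CayAdj-id⇔
      (CayAdj-resp S {g id} {id} {g s} {g s} g-id (λ _ → refl) (to (adj id s) (from CayAdj-id⇔ Ss)))

    g-onto-S : {t : Perm n} → S t → ∃ λ s → S s × g s ≈ t
    g-onto-S {t} St = ginv t , to CayAdj-id⇔ (from (adj id (ginv t)) id~ginv-t) , invʳ t
      where
      id~ginv-t : CayAdj S (g id) (g (ginv t))
      id~ginv-t = CayAdj-resp S {id} {g id} {t} {g (ginv t)}
                    (λ z → sym (g-id z)) (λ z → sym (invʳ t z)) (from CayAdj-id⇔ St)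

    CommonNbr-image : {s t y : Perm n} → CommonNbr S s t y → CommonNbr S (g s) (g t) (g y)
    CommonNbr-image {s} {t} {y} (s~y , t~y) = to (adj s y) s~y , to (adj t y) t~y

    CommonNbr-preimage : {s t y : Perm n} → CommonNbr S (g s) (g t) y → CommonNbr S s t (ginv y)
    CommonNbr-preimage {s} {t} {y} (gs~y , gt~y) = pull s gs~y , pull t gt~y
      where
      pull : ∀ u → CayAdj S (g u) y → CayAdj S u (ginv y)
      pull u gu~y = from (adj u (ginv y))
        (CayAdj-resp S {g u} {g u} {y} {g (ginv y)} (λ _ → refl) (λ z → sym (invʳ y z)) gu~y)

    UniqueNonIdCommonNbr-image : {s t : Perm n} →
                                 UniqueNonIdCommonNbr S s t → UniqueNonIdCommonNbr S (g s) (g t)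
    UniqueNonIdCommonNbr-image (x , x≉id , common , unique) =
      g x , (λ gx≈id → x≉id (g-injective {x} {id} λ z → trans (gx≈id z) (sym (g-id z)))) ,
      CommonNbr-image common ,
      λ y common′ → map
        (λ ginv-y≈id z → trans (sym (invʳ y z)) (trans (g-cong ginv-y≈id z) (g-id z)))
        (λ ginv-y≈x z → trans (sym (invʳ y z)) (g-cong ginv-y≈x z))
        (unique (ginv y) (CommonNbr-preimage common′))

    UniqueNonIdCommonNbr-preimage : {s t : Perm n} →
                                    UniqueNonIdCommonNbr S (g s) (g t) → UniqueNonIdCommonNbr S s t
    UniqueNonIdCommonNbr-preimage (x , x≉id , common , unique) =
      ginv x , (λ ginv-x≈id → x≉id λ z → trans (sym (invʳ x z)) (trans (g-cong ginv-x≈id z) (g-id z))) ,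
      CommonNbr-preimage common ,
      λ y common′ → map
        (λ gy≈id → g-injective {y} {id} λ z → trans (gy≈id z) (sym (g-id z)))
        (λ gy≈x → g-injective {y} {ginv x} λ z → trans (gy≈x z) (sym (invʳ x z)))
        (unique (g y) (CommonNbr-image common′))

    LineAdj-preserved : {s t : Perm n} → S s → S t → LineAdj s t ⇔ LineAdj (g s) (g t)
    LineAdj-preserved {s} {t} Ss St =
      ⇔-sym (LineAdj⇔¬uniqueNonIdCommonNbr (g-maps-S Ss) (g-maps-S St))
      ⇔-∘ ((¬-cong-⇔ (mk⇔ g-cong g-injective)
            ×-⇔ ¬-cong-⇔ (mk⇔ UniqueNonIdCommonNbr-image UniqueNonIdCommonNbr-preimage))
      ⇔-∘ LineAdj⇔¬uniqueNonIdCommonNbr Ss St)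

mainTheorem4 : (n : ℕ) (S : SubsetOf n) → Respects≈ S →
    (∀ s → S s → IsTransposition s) → Generates S →
    (g : Perm n → Perm n) → IsCayAut S g → g id ≈ id →
    IsLineGraphAutOn S g
mainTheorem4 n S S-resp S-tr _ g aut g-id =
  (λ _ → g-maps-S) ,
  (λ s t _ _ → g-injective {s} {t}) ,
  (λ _ → g-onto-S) ,
  (λ _ _ → LineAdj-preserved)
  where open CayleyAutomorphism S-resp S-tr aut g-id
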